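{- Let $S_I$ be a connected shape of order $n$ contained in an $n\times n$ square box of grid cells, and partition this box uniformly into $\sqrt{n}\times\sqrt{n}$ sub-boxes. Then $S_I$ occupies (has at least one node in) at most $O(\sqrt{n})$ of these sub-boxes, with the implied constant independent of $n$ and of the shape.
   Context: Nodes occupy distinct cells of the two-dimensional square grid, cells addressed by integer coordinates. A shape is a finite set of nodes; its order is its number of nodes. Two nodes $(x_1,y_1),(x_2,y_2)$ are neighbours iff $|x_1-x_2|\le 1$ and $|y_1-y_2|\le 1$; a shape is connected iff the graph on its nodes given by this neighbour relation is connected. -}

module Defs where

open import Data.Nat using (ℕ; _<_; _≤_; _*_; ∣_-_∣; NonZero)
open import Data.Nat.DivMod using (_/_)
open import Data.Nat.Properties using (_≟_)
open import Data.Product using (_×_; _,_; proj₁; proj₂)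
open import Data.List using (List; length; filter; upTo; cartesianProduct)
open import Data.List.Membership.Propositional using (_∈_)
open import Data.List.Relation.Unary.Any using (Any; any?)
open import Data.List.Relation.Unary.All using (All)
open import Data.List.Relation.Unary.Unique.Propositional using (Unique)
open import Relation.Binary.PropositionalEquality using (_≡_)
open import Relation.Nullary.Decidable using (_×-dec_)

-- A node is a grid cell; the n×n box is placed (w.l.o.g., up to translation)
-- at {0,…,n-1}², so nodes inside it have natural-number coordinates.
Node : Set
Node = ℕ × ℕ

record Shape : Set where
  constructor shape
  field
    nodes    : List Node
    distinct : Unique nodes
open Shape public

order : Shape → ℕ
order S = length (nodes S)

Neighbours : Node → Node → Set
Neighbours (x₁ , y₁) (x₂ , y₂) = ∣ x₁ - x₂ ∣ ≤ 1 × ∣ y₁ - y₂ ∣ ≤ 1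

data Walk (S : Shape) : Node → Node → Set where
  here : ∀ {u} → u ∈ nodes S → Walk S u u
  step : ∀ {u v w} → u ∈ nodes S → Neighbours u v → Walk S v w → Walk S u w

Connected : Shape → Set
Connected S = ∀ {u v} → u ∈ nodes S → v ∈ nodes S → Walk S u v

InBox : ℕ → Shape → Set
InBox n S = All (λ p → proj₁ p < n × proj₂ p < n) (nodes S)

-- The box of side n = k*k is partitioned into k×k sub-boxes of side k;
-- the sub-box (i , j), with i , j < k, is {k i,…,k i+k-1} × {k j,…,k j+k-1}.
occupiedCount : (k : ℕ) .{{_ : NonZero k}} → Shape → ℕ
occupiedCount k S =
  length (filter (λ b → any? (λ p → (proj₁ p / k ≟ proj₁ b) ×-dec (proj₂ p / k ≟ proj₂ b)) (nodes S))
                 (cartesianProduct (upTo k) (upTo k)))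

module Submission where

-- Give sub-box b the corner c_b = (k·i , k·j) and the halo
-- H_b = {p : dist∞(c_b , p) < 2k}.
--  (1) If b is occupied, H_b contains at least k nodes of S.  A node of S in
--      b has distance < k from c_b.  Either every node of S lies in H_b, and
--      there are k² ≥ k of them, or some node has distance ≥ 2k; since the
--      distance to c_b changes by at most one per step of a walk, every value
--      k, …, 2k-1 is then the distance of some node of S.
--  (2) A node p lies in at most 16 halos: both block indices of b lie in a
--      window of 4 consecutive values determined by p.
-- Double counting the pairs (occupied b , p ∈ S ∩ H_b) gives
-- (#occupied)·k ≤ 16·k², i.e. #occupied ≤ 16·k.

open import Defs
open import Data.Nat
  using (ℕ; zero; suc; _+_; _*_; _∸_; _⊔_; _⊓_; _≤_; _<_; z≤n; s≤s; s≤s⁻¹; _≤?_; _<?_; _≟_; ∣_-_∣; NonZero)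
open import Data.Nat.Properties
open import Data.Nat.DivMod using (_/_; _%_; m%n<n; m%n≡m∸m/n*n; m/n*n≤m; m<n*o⇒m/o<n; m≡m%n+[m/n]*n)
open import Data.Nat.ListAction using (sum)
open import Algebra.Properties.CommutativeSemigroup +-commutativeSemigroup using (interchange)
open import Data.Product using (Σ; _×_; _,_; proj₁; proj₂)
open import Data.List using (List; []; _∷_; [_]; _++_; length; filter; map; upTo; cartesianProduct)
open import Data.List.Properties using (filter-++; length-++; filter-all; filter-accept; filter-reject; upTo-∷ʳ)
open import Data.List.Membership.Propositional using (_∈_; lose; find)
open import Data.List.Membership.Propositional.Properties using (∈-filter⁺)
open import Data.List.Relation.Unary.Any using (Any; here; there; any?)
open import Data.List.Relation.Unary.All as All using (All; []; _∷_)
open import Data.List.Relation.Unary.All.Properties using (all-filter; ¬Any⇒All¬)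
open import Data.List.Relation.Binary.Sublist.Propositional using (_⊆_; ⊆-refl)
open import Data.List.Relation.Binary.Sublist.Propositional.Properties using (filter⁺; filter-⊆; length-mono-≤)
open import Relation.Binary.Definitions using (tri<; tri≈; tri>)
open import Relation.Binary.PropositionalEquality using (_≡_; refl; sym; trans; cong; cong₂; module ≡-Reasoning)
open import Relation.Nullary using (Dec; yes; no; ¬_)
open import Relation.Nullary.Decidable using (_×-dec_)
open import Relation.Unary using (Decidable)
open import Function using (_∘_)

indicator : {X : Set} → Dec X → ℕ
indicator (yes _) = 1
indicator (no _)  = 0

module _ {A : Set} where

  count : {P : A → Set} → Decidable P → List A → ℕ
  count P? xs = length (filter P? xs)

  count-mono : {P Q : A → Set} (P? : Decidable P) (Q? : Decidable Q) →
               (∀ {x} → P x → Q x) → ∀ {xs ys} → xs ⊆ ys → count P? xs ≤ count Q? ys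
  count-mono P? Q? P⇒Q xs⊆ys = length-mono-≤ (filter⁺ P? Q? (λ { refl → P⇒Q }) xs⊆ys)

  count-++ : {P : A → Set} (P? : Decidable P) → ∀ xs ys →
             count P? (xs ++ ys) ≡ count P? xs + count P? ys
  count-++ P? xs ys = trans (cong length (filter-++ P? xs ys)) (length-++ (filter P? xs))

  count-∷ : {P : A → Set} (P? : Decidable P) → ∀ x xs → count P? (x ∷ xs) ≡ indicator (P? x) + count P? xs
  count-∷ P? x xs with P? x
  ... | yes _ = refl
  ... | no _  = refl

  count-∷-yes : {P : A → Set} (P? : Decidable P) → ∀ {x xs} → P x → count P? (x ∷ xs) ≡ suc (count P? xs)
  count-∷-yes P? px = cong length (filter-accept P? px)

  count-∷-no : {P : A → Set} (P? : Decidable P) → ∀ {x xs} → ¬ P x → count P? (x ∷ xs) ≡ count P? xs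
  count-∷-no P? ¬px = cong length (filter-reject P? ¬px)

  count-all : {P : A → Set} (P? : Decidable P) → ∀ {xs} → All P xs → count P? xs ≡ length xs
  count-all P? all = cong length (filter-all P? all)

  count-any : {P : A → Set} (P? : Decidable P) → ∀ {xs} → Any P xs → 0 < count P? xs
  count-any P? witness with find witness
  ... | x , x∈xs , px = nonempty (∈-filter⁺ P? x∈xs px)
    where
    nonempty : ∀ {ys} → x ∈ ys → 0 < length ys
    nonempty (here _)  = s≤s z≤n
    nonempty (there _) = s≤s z≤n

InWindow : ℕ → ℕ → ℕ → Set
InWindow lo w i = lo ≤ i × i < lo + w

inWindow? : ∀ lo w → Decidable (InWindow lo w)
inWindow? lo w i = (lo ≤? i) ×-dec (i <? lo + w)

window-count : ∀ lo w n → count (inWindow? lo w) (upTo n) ≤ w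
window-count lo w n = ≤-trans (bound n) (m⊓n≤n (n ∸ lo) w)
  where
  -- invariant: no number below lo is counted
  bound : ∀ n → count (inWindow? lo w) (upTo n) ≤ (n ∸ lo) ⊓ w
  bound zero    = z≤n
  bound (suc n) = begin
      count (inWindow? lo w) (upTo (suc n))
        ≡⟨ cong (count (inWindow? lo w)) (sym (upTo-∷ʳ n)) ⟩
      count (inWindow? lo w) (upTo n ++ [ n ])
        ≡⟨ count-++ (inWindow? lo w) (upTo n) [ n ] ⟩
      count (inWindow? lo w) (upTo n) + count (inWindow? lo w) [ n ]
        ≤⟨ last ⟩
      (suc n ∸ lo) ⊓ w ∎
    where
    open ≤-Reasoning
    c : ℕ
    c = count (inWindow? lo w) (upTo n)
    last : c + count (inWindow? lo w) [ n ] ≤ (suc n ∸ lo) ⊓ w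
    last with inWindow? lo w n
    ... | yes n∈window@(lo≤n , n<lo+w) =
      ⊓-glb c+1≤1+n∸lo (≤-trans c+1≤1+n∸lo (m≤n+o⇒m∸n≤o (suc n) lo n<lo+w))
      where
      c+1≤1+n∸lo : c + count (inWindow? lo w) [ n ] ≤ suc n ∸ lo
      c+1≤1+n∸lo = begin
          c + count (inWindow? lo w) [ n ] ≡⟨ cong (c +_) (count-∷-yes (inWindow? lo w) n∈window) ⟩
          c + 1                            ≤⟨ +-monoˡ-≤ 1 (≤-trans (bound n) (m⊓n≤m (n ∸ lo) w)) ⟩
          n ∸ lo + 1                       ≡⟨ +-comm (n ∸ lo) 1 ⟩
          1 + (n ∸ lo)                     ≡⟨ sym (+-∸-assoc 1 lo≤n) ⟩
          suc n ∸ lo                       ∎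
    ... | no n∉window = begin
        c + count (inWindow? lo w) [ n ] ≡⟨ cong (c +_) (count-∷-no (inWindow? lo w) n∉window) ⟩
        c + 0                            ≡⟨ +-identityʳ c ⟩
        c                                ≤⟨ bound n ⟩
        (n ∸ lo) ⊓ w                     ≤⟨ ⊓-monoˡ-≤ w (∸-monoˡ-≤ lo (n≤1+n n)) ⟩
        (suc n ∸ lo) ⊓ w                 ∎

module _ {A B : Set} {P : A → Set} {Q : B → Set} (P? : Decidable P) (Q? : Decidable Q) where

  both? : Decidable (λ (ab : A × B) → P (proj₁ ab) × Q (proj₂ ab))
  both? (a , b) = P? a ×-dec Q? b

  count-× : ∀ xs ys → count both? (cartesianProduct xs ys) ≡ count P? xs * count Q? ys
  count-× []       ys = refl
  count-× (x ∷ xs) ys with P? x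
  ... | yes px = trans (count-++ both? (map (x ,_) ys) _) (cong₂ _+_ (row ys) (count-× xs ys))
    where
    row : ∀ ys → count both? (map (x ,_) ys) ≡ count Q? ys
    row []       = refl
    row (y ∷ ys) = head (Q? y)
      where
      head : Dec (Q y) → count both? ((x , y) ∷ map (x ,_) ys) ≡ count Q? (y ∷ ys)
      head (yes qy) = trans (count-∷-yes both? (px , qy)) (trans (cong suc (row ys)) (sym (count-∷-yes Q? qy)))
      head (no ¬qy) = trans (count-∷-no both? (¬qy ∘ proj₂)) (trans (row ys) (sym (count-∷-no Q? ¬qy)))
  ... | no ¬px = trans (count-++ both? (map (x ,_) ys) _) (cong₂ _+_ (row ys) (count-× xs ys))
    where
    row : ∀ ys → count both? (map (x ,_) ys) ≡ 0
    row []       = refl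
    row (y ∷ ys) = trans (count-∷-no both? (¬px ∘ proj₁)) (row ys)

module _ {A : Set} (f : A → ℕ) where

  count-below-suc : ∀ s xs →
    count (λ x → f x <? suc s) xs ≡ count (λ x → f x <? s) xs + count (λ x → f x ≟ s) xs
  count-below-suc s = split
    where
    open ≡-Reasoning
    below1+s : Decidable (λ y → f y < suc s)
    below1+s y = f y <? suc s
    below-s : Decidable (λ y → f y < s)
    below-s y = f y <? s
    equal-s : Decidable (λ y → f y ≡ s)
    equal-s y = f y ≟ s
    split : ∀ xs → count below1+s xs ≡ count below-s xs + count equal-s xs
    split []       = refl
    split (x ∷ xs) with <-cmp (f x) s
    ... | tri< fx<s fx≢s _ = begin
        count below1+s (x ∷ xs)                      ≡⟨ count-∷-yes below1+s (m<n⇒m<1+n fx<s) ⟩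
        suc (count below1+s xs)                      ≡⟨ cong suc (split xs) ⟩
        suc (count below-s xs) + count equal-s xs    ≡⟨ cong₂ _+_ (count-∷-yes below-s fx<s) (count-∷-no equal-s fx≢s) ⟨
        count below-s (x ∷ xs) + count equal-s (x ∷ xs) ∎
    ... | tri≈ fx≮s fx≡s _ = begin
        count below1+s (x ∷ xs)                      ≡⟨ count-∷-yes below1+s (s≤s (≤-reflexive fx≡s)) ⟩
        suc (count below1+s xs)                      ≡⟨ cong suc (split xs) ⟩
        suc (count below-s xs + count equal-s xs)    ≡⟨ +-suc _ _ ⟨
        count below-s xs + suc (count equal-s xs)    ≡⟨ cong₂ _+_ (count-∷-no below-s fx≮s) (count-∷-yes equal-s fx≡s) ⟨
        count below-s (x ∷ xs) + count equal-s (x ∷ xs) ∎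
    ... | tri> fx≮s fx≢s s<fx = begin
        count below1+s (x ∷ xs)                      ≡⟨ count-∷-no below1+s (λ fx<1+s → <⇒≱ s<fx (s≤s⁻¹ fx<1+s)) ⟩
        count below1+s xs                            ≡⟨ split xs ⟩
        count below-s xs + count equal-s xs          ≡⟨ cong₂ _+_ (count-∷-no below-s fx≮s) (count-∷-no equal-s fx≢s) ⟨
        count below-s (x ∷ xs) + count equal-s (x ∷ xs) ∎

  levels-count : ∀ a m xs → (∀ t → a ≤ t → t < m + a → Any (λ x → f x ≡ t) xs) →
                 m ≤ count (λ x → f x <? m + a) xs
  levels-count a zero    xs taken = z≤n
  levels-count a (suc m) xs taken = begin
      suc m
        ≡⟨ +-comm 1 m ⟩
      m + 1
        ≤⟨ +-mono-≤ (levels-count a m xs (λ t a≤t t<m+a → taken t a≤t (m<n⇒m<1+n t<m+a)))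
                    (count-any (λ x → f x ≟ m + a) (taken (m + a) (m≤n+m a m) (n<1+n (m + a)))) ⟩
      count (λ x → f x <? m + a) xs + count (λ x → f x ≟ m + a) xs
        ≡⟨ sym (count-below-suc (m + a) xs) ⟩
      count (λ x → f x <? suc m + a) xs ∎
    where open ≤-Reasoning

module _ {A B : Set} {R : A → B → Set} (R? : ∀ a b → Dec (R a b)) where

  incidences : List A → List B → ℕ
  incidences as bs = sum (map (λ a → count (R? a) bs) as)

  incidences-[] : ∀ as → incidences as [] ≡ 0
  incidences-[] []       = refl
  incidences-[] (_ ∷ as) = incidences-[] as

  -- incidences can equally be counted from the side of bs
  incidences-∷ : ∀ as b bs → incidences as (b ∷ bs) ≡ count (λ a → R? a b) as + incidences as bs
  incidences-∷ []       b bs = refl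
  incidences-∷ (a ∷ as) b bs = begin
      count (R? a) (b ∷ bs) + incidences as (b ∷ bs)
        ≡⟨ cong₂ _+_ (count-∷ (R? a) b bs) (incidences-∷ as b bs) ⟩
      (related + count (R? a) bs) + (count (λ a′ → R? a′ b) as + incidences as bs)
        ≡⟨ interchange related (count (R? a) bs) (count (λ a′ → R? a′ b) as) (incidences as bs) ⟩
      (related + count (λ a′ → R? a′ b) as) + (count (R? a) bs + incidences as bs)
        ≡⟨ cong (_+ incidences (a ∷ as) bs) (count-∷ (λ a′ → R? a′ b) a as) ⟨
      count (λ a′ → R? a′ b) (a ∷ as) + incidences (a ∷ as) bs ∎
    where
    open ≡-Reasoning
    related : ℕ
    related = indicator (R? a b)

  double-count : ∀ {m c} as bs → All (λ a → m ≤ count (R? a) bs) as →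
                 (∀ b → count (λ a → R? a b) as ≤ c) → length as * m ≤ length bs * c
  double-count {m} {c} as bs lower upper = ≤-trans (below as lower) (above bs)
    where
    below : ∀ as → All (λ a → m ≤ count (R? a) bs) as → length as * m ≤ incidences as bs
    below []       []         = z≤n
    below (_ ∷ as) (ma ∷ mas) = +-mono-≤ ma (below as mas)
    above : ∀ bs → incidences as bs ≤ length bs * c
    above []       = ≤-reflexive (incidences-[] as)
    above (b ∷ bs) = ≤-trans (≤-reflexive (incidences-∷ as b bs)) (+-mono-≤ (upper b) (above bs))

StepBounded : (Node → ℕ) → Set
StepBounded f = ∀ {u v} → Neighbours u v → f v ≤ suc (f u)

walk-ivt : ∀ {S f} → StepBounded f → ∀ {u w} t → Walk S u w → f u ≤ t → t ≤ f w →
           Any (λ p → f p ≡ t) (nodes S)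
walk-ivt bounded t (here u∈S) fu≤t t≤fw = lose u∈S (≤-antisym fu≤t t≤fw)
walk-ivt {f = f} bounded t (step {v = v} u∈S u~v walk) fu≤t t≤fw with f v ≤? t
... | yes fv≤t = walk-ivt bounded t walk fv≤t t≤fw
... | no fv≰t  = lose u∈S (≤-antisym fu≤t (s≤s⁻¹ (≤-trans (≰⇒> fv≰t) (bounded u~v))))

dist : Node → Node → ℕ
dist (x₁ , y₁) (x₂ , y₂) = ∣ x₁ - x₂ ∣ ⊔ ∣ y₁ - y₂ ∣

dist-stepBounded : ∀ c → StepBounded (dist c)
dist-stepBounded (c₁ , c₂) {u₁ , u₂} {v₁ , v₂} (u₁~v₁ , u₂~v₂) =
  ⊔-lub (axis c₁ u₁ v₁ (m≤m⊔n _ _) u₁~v₁) (axis c₂ u₂ v₂ (m≤n⊔m _ _) u₂~v₂)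
  where
  axis : ∀ {e} c u v → ∣ c - u ∣ ≤ e → ∣ u - v ∣ ≤ 1 → ∣ c - v ∣ ≤ suc e
  axis {e} c u v cu≤e uv≤1 = begin
      ∣ c - v ∣             ≤⟨ ∣-∣-triangle c u v ⟩
      ∣ c - u ∣ + ∣ u - v ∣ ≤⟨ +-mono-≤ cu≤e uv≤1 ⟩
      e + 1                 ≡⟨ +-comm e 1 ⟩
      suc e                 ∎
    where open ≤-Reasoning

module SubBoxes (k : ℕ) .{{_ : NonZero k}} where

  corner : Node → Node
  corner (i , j) = (i * k , j * k)

  Near : Node → Node → Set
  Near b p = dist (corner b) p < k + k

  near? : ∀ b p → Dec (Near b p)
  near? b p = dist (corner b) p <? k + k

  axis-inside : ∀ x i → x / k ≡ i → ∣ i * k - x ∣ < k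
  axis-inside x _ refl = begin-strict
      ∣ x / k * k - x ∣ ≡⟨ m≤n⇒∣m-n∣≡n∸m (m/n*n≤m x k) ⟩
      x ∸ x / k * k     ≡⟨ sym (m%n≡m∸m/n*n x k) ⟩
      x % k             <⟨ m%n<n x k ⟩
      k                 ∎
    where open ≤-Reasoning

  axis-window : ∀ x i → ∣ i * k - x ∣ < k + k → InWindow (x / k ∸ 1) 4 i
  axis-window x i close = ∸-monoˡ-≤ 1 (s≤s⁻¹ (m<n*o⇒m/o<n x<[2+i]k)) , i<lo+4
    where
    open ≤-Reasoning
    x<[2+i]k : x < suc (suc i) * k
    x<[2+i]k = begin-strict
        x                     ≤⟨ m≤∣m-n∣+n x (i * k) ⟩
        ∣ x - i * k ∣ + i * k ≡⟨ cong (_+ i * k) (∣-∣-comm x (i * k)) ⟩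
        ∣ i * k - x ∣ + i * k <⟨ +-monoˡ-< (i * k) close ⟩
        k + k + i * k         ≡⟨ +-assoc k k (i * k) ⟩
        suc (suc i) * k       ∎
    q : ℕ
    q = x / k
    x<k+qk : x < k + q * k
    x<k+qk = begin-strict
        x             ≡⟨ m≡m%n+[m/n]*n x k ⟩
        x % k + q * k <⟨ +-monoˡ-< (q * k) (m%n<n x k) ⟩
        k + q * k     ∎
    ik<[3+q]k : i * k < (3 + q) * k
    ik<[3+q]k = begin-strict
        i * k                   ≤⟨ m≤n+∣m-n∣ (i * k) x ⟩
        x + ∣ i * k - x ∣       <⟨ +-monoʳ-< x close ⟩
        x + (k + k)             <⟨ +-monoˡ-< (k + k) x<k+qk ⟩
        (k + q * k) + (k + k)   ≡⟨ +-comm (k + q * k) (k + k) ⟩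
        (k + k) + (k + q * k)   ≡⟨ +-assoc k k (k + q * k) ⟩
        (3 + q) * k             ∎
    i<lo+4 : i < q ∸ 1 + 4
    i<lo+4 = begin-strict
        i             <⟨ *-cancelʳ-< k i (3 + q) ik<[3+q]k ⟩
        3 + q         ≤⟨ +-monoʳ-≤ 3 (m≤n+m∸n q 1) ⟩
        4 + (q ∸ 1)   ≡⟨ +-comm 4 (q ∸ 1) ⟩
        q ∸ 1 + 4     ∎

  boxes : List Node
  boxes = cartesianProduct (upTo k) (upTo k)

  halo-count : ∀ p → count (λ b → near? b p) boxes ≤ 16
  halo-count (x , y) = begin
      count (λ b → near? b (x , y)) boxes
        ≤⟨ count-mono (λ b → near? b (x , y)) (both? windowX? windowY?) near⇒windows (⊆-refl {x = boxes}) ⟩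
      count (both? windowX? windowY?) boxes
        ≡⟨ count-× windowX? windowY? (upTo k) (upTo k) ⟩
      count windowX? (upTo k) * count windowY? (upTo k)
        ≤⟨ *-mono-≤ (window-count (x / k ∸ 1) 4 k) (window-count (y / k ∸ 1) 4 k) ⟩
      16 ∎
    where
    open ≤-Reasoning
    windowX? : Decidable (InWindow (x / k ∸ 1) 4)
    windowX? = inWindow? (x / k ∸ 1) 4
    windowY? : Decidable (InWindow (y / k ∸ 1) 4)
    windowY? = inWindow? (y / k ∸ 1) 4
    near⇒windows : ∀ {b} → Near b (x , y) → InWindow (x / k ∸ 1) 4 (proj₁ b) × InWindow (y / k ∸ 1) 4 (proj₂ b)
    near⇒windows {i , j} near =
      axis-window x i (m⊔n<o⇒m<o _ _ near) , axis-window y j (m⊔n<o⇒n<o _ _ near)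

  Occupied : Shape → Node → Set
  Occupied S b = Any (λ p → (proj₁ p / k ≡ proj₁ b) × (proj₂ p / k ≡ proj₂ b)) (nodes S)

  occupied-halo : ∀ S b → Connected S → order S ≡ k * k → Occupied S b → k ≤ count (near? b) (nodes S)
  occupied-halo S b connected order≡k² occupied with any? (λ w → k + k ≤? dist (corner b) w) (nodes S)
  ... | yes someFar with find occupied | find someFar
  ...   | (u₁ , u₂) , u∈S , (u₁∈b , u₂∈b) | w , w∈S , w-far =
    levels-count (dist (corner b)) k k (nodes S) λ t k≤t t<2k →
      walk-ivt (dist-stepBounded (corner b)) t (connected u∈S w∈S)
               (<⇒≤ (<-≤-trans u-close k≤t)) (<⇒≤ (<-≤-trans t<2k w-far))
    where
    u-close : dist (corner b) (u₁ , u₂) < k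
    u-close = ⊔-lub (axis-inside u₁ (proj₁ b) u₁∈b) (axis-inside u₂ (proj₂ b) u₂∈b)
  occupied-halo S b connected order≡k² occupied | no noneFar = begin
      k                         ≤⟨ m≤m*n k k ⟩
      k * k                     ≡⟨ sym order≡k² ⟩
      length (nodes S)          ≡⟨ sym (count-all (near? b) allNear) ⟩
      count (near? b) (nodes S) ∎
    where
    open ≤-Reasoning
    allNear : All (Near b) (nodes S)
    allNear = All.map ≰⇒> (¬Any⇒All¬ (nodes S) noneFar)

  occupied-bound : (S : Shape) → Connected S → order S ≡ k * k → occupiedCount k S ≤ 16 * k
  occupied-bound S connected order≡k² = *-cancelʳ-≤ (occupiedCount k S) (16 * k) k (begin
      occupiedCount k S * k ≤⟨ double-count near? occupiedBoxes (nodes S) lower upper ⟩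
      order S * 16          ≡⟨ cong (_* 16) order≡k² ⟩
      k * k * 16            ≡⟨ *-comm (k * k) 16 ⟩
      16 * (k * k)          ≡⟨ sym (*-assoc 16 k k) ⟩
      16 * k * k            ∎)
    where
    open ≤-Reasoning
    occupied? : Decidable (Occupied S)
    occupied? b = any? (λ p → (proj₁ p / k ≟ proj₁ b) ×-dec (proj₂ p / k ≟ proj₂ b)) (nodes S)
    occupiedBoxes : List Node
    occupiedBoxes = filter occupied? boxes
    lower : All (λ b → k ≤ count (near? b) (nodes S)) occupiedBoxes
    lower = All.map (occupied-halo S _ connected order≡k²) (all-filter occupied? boxes)
    upper : ∀ p → count (λ b → near? b p) occupiedBoxes ≤ 16
    upper p = ≤-trans (count-mono (λ b → near? b p) (λ b → near? b p) (λ near → near) (filter-⊆ occupied? boxes))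
                      (halo-count p)

lemma4p1 : Σ ℕ (λ C → (k : ℕ) .{{_ : NonZero k}} → (S : Shape) →
             Connected S → order S ≡ k * k → InBox (k * k) S →
             occupiedCount k S ≤ C * k)
lemma4p1 = 16 , λ k S connected order≡k² _ → SubBoxes.occupied-bound k S connected order≡k²
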